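{- There is no first-order formula $\psi(x,y)$ over the vocabulary $\{\preceq\}$ such that, for every decision tree $\mathcal{T}$ and every pair of partial instances $\mathbf{e},\mathbf{e}'$ of dimension $\dim(\mathcal{T})$, $\mathcal{T}\models\psi(\mathbf{e},\mathbf{e}')$ if and only if $\mathbf{e}$ is subsumed by $\mathbf{e}'$.
   Context: Partial instances of dimension $n$ are tuples in $\{0,1,\bot\}^n$; $\mathbf{e}_\bot=\{i\mid\mathbf{e}[i]=\bot\}$; $\mathbf{e}$ is subsumed by $\mathbf{e}'$ if $\mathbf{e}[i]=\mathbf{e}'[i]$ for every $i$ with $\mathbf{e}[i]\neq\bot$. A decision tree of dimension $n$ is a rooted binary tree with internal nodes labeled by features in $\{1,\dots,n\}$, edges labeled $0/1$, leaves labeled $\mathsf{true}/\mathsf{false}$, no feature repeated on a root-to-leaf path. A formula over $\{\preceq\}$ is evaluated on $\mathcal{T}$ of dimension $n$ over the domain $\{0,1,\bot\}^n$ with $\mathbf{e}\preceq\mathbf{e}'$ iff $|\mathbf{e}_\bot|\ge|\mathbf{e}'_\bot|$. -}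

module Defs where

open import Data.Nat using (ℕ; zero; suc; _≥_)
open import Data.Bool using (Bool)
open import Data.Fin using (Fin)
open import Data.Vec using (Vec; []; _∷_; lookup)
open import Data.List using (List; []; _∷_)
open import Data.List.Membership.Propositional using (_∉_)
open import Data.Product using (Σ; _×_)
open import Data.Sum using (_⊎_)
open import Data.Unit using (⊤)
open import Data.Empty using (⊥)
open import Relation.Nullary using (¬_)
open import Relation.Binary.PropositionalEquality using (_≡_; _≢_)

data PVal : Set where
  v0 v1 bot : PVal

PInst : ℕ → Set
PInst n = Vec PVal n

countBot : ∀ {n} → PInst n → ℕ
countBot [] = zero
countBot (bot ∷ e) = suc (countBot e)
countBot (v0 ∷ e) = countBot e
countBot (v1 ∷ e) = countBot e

Subsumed : ∀ {n} → PInst n → PInst n → Set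
Subsumed {n} e e' = (i : Fin n) → lookup e i ≢ bot → lookup e i ≡ lookup e' i

_≼_ : ∀ {n} → PInst n → PInst n → Set
e ≼ e' = countBot e ≥ countBot e'

-- Raw decision trees over features 1..n (here Fin n):
-- node i t₀ t₁ tests feature i, t₀ is the 0-child, t₁ the 1-child.
data DTree (n : ℕ) : Set where
  leaf : Bool → DTree n
  node : Fin n → DTree n → DTree n → DTree n

NoRepeat : ∀ {n} → List (Fin n) → DTree n → Set
NoRepeat used (leaf b) = ⊤
NoRepeat used (node i t₀ t₁) = (i ∉ used) × NoRepeat (i ∷ used) t₀ × NoRepeat (i ∷ used) t₁

DecisionTree : ℕ → Set
DecisionTree n = Σ (DTree n) (NoRepeat [])

-- First-order formulas over vocabulary {≼} (with equality),
-- with k free variables (de Bruijn indices Fin k).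
data Formula (k : ℕ) : Set where
  prec : Fin k → Fin k → Formula k
  eq   : Fin k → Fin k → Formula k
  ¬'   : Formula k → Formula k
  _∧'_ : Formula k → Formula k → Formula k
  _∨'_ : Formula k → Formula k → Formula k
  _⇒'_ : Formula k → Formula k → Formula k
  ∃'   : Formula (suc k) → Formula k
  ∀'   : Formula (suc k) → Formula k

extend : ∀ {A : Set} {k} → A → (Fin k → A) → Fin (suc k) → A
extend a ρ Fin.zero = a
extend a ρ (Fin.suc i) = ρ i

Sat : ∀ {n k} → DecisionTree n → Formula k → (Fin k → PInst n) → Set
Sat T (prec x y) ρ = ρ x ≼ ρ y
Sat T (eq x y) ρ = ρ x ≡ ρ y
Sat T (¬' φ) ρ = ¬ Sat T φ ρ
Sat T (φ ∧' ψ) ρ = Sat T φ ρ × Sat T ψ ρ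
Sat T (φ ∨' ψ) ρ = Sat T φ ρ ⊎ Sat T ψ ρ
Sat T (φ ⇒' ψ) ρ = Sat T φ ρ → Sat T ψ ρ
Sat {n} T (∃' φ) ρ = Σ (PInst n) (λ a → Sat T φ (extend a ρ))
Sat {n} T (∀' φ) ρ = (a : PInst n) → Sat T φ (extend a ρ)

pair : ∀ {A : Set} → A → A → Fin 2 → A
pair a b Fin.zero = a
pair a b (Fin.suc _) = b

module Submission where

open import Defs
open import Data.Nat using (ℕ; _≤_)
open import Data.Bool using (true)
open import Data.Unit using (tt)
open import Data.Empty using (⊥-elim)
open import Data.Fin using (Fin; zero; suc)
open import Data.Vec using ([]; _∷_)
open import Data.Product using (Σ; _×_; _,_; proj₁; proj₂)
open import Data.Product.Function.NonDependent.Propositional using (_×-⇔_)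
open import Data.Product.Function.Dependent.Propositional using (Σ-⇔)
open import Data.Sum.Function.Propositional using (_⊎-⇔_)
open import Function using (_↔_; _⇔_; Inverse; Injection; Equivalence; mk⇔; mk↔ₛ′)
open import Function.Properties.Inverse using (↔⇒↠; ↔⇒↣)
open import Function.Related.TypeIsomorphisms using (→-cong-⇔; ¬-cong-⇔)
open import Relation.Nullary using (¬_)
open import Relation.Binary.PropositionalEquality using (_≡_; refl; sym; cong; subst; subst₂)

-- Satisfaction of a {≼}-formula is invariant under any permutation of {0,1,⊥}ⁿ
-- preserving the number of ⊥ entries, since such a permutation is an
-- automorphism of the structure ({0,1,⊥}ⁿ, ≼). In dimension 2 the
-- transposition of (0,⊥) and (1,⊥) is one; it fixes (0,0) and so moves the
-- subsumed pair ((0,⊥),(0,0)) to the pair ((1,⊥),(0,0)), which is not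
-- subsumed.

Π-⇔ : ∀ {I J : Set} {A : I → Set} {B : J → Set} (π : I ↔ J) →
      (∀ {i} → A i ⇔ B (Inverse.to π i)) → ((i : I) → A i) ⇔ ((j : J) → B j)
Π-⇔ {B = B} π A⇔B = mk⇔
  (λ f j → subst B (strictlyInverseˡ j) (Equivalence.to A⇔B (f (from j))))
  (λ g i → Equivalence.from A⇔B (g (to i)))
  where open Inverse π

module BotCountPreserving {n : ℕ} (π : PInst n ↔ PInst n)
         (countBot-π : ∀ e → countBot (Inverse.to π e) ≡ countBot e) where

  open Inverse π using (to)

  Transports : ∀ {k} → (Fin k → PInst n) → (Fin k → PInst n) → Set
  Transports ρ ρ' = ∀ i → ρ' i ≡ to (ρ i)

  extend-transports : ∀ {k} {ρ ρ' : Fin k → PInst n} a →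
                      Transports ρ ρ' → Transports (extend a ρ) (extend (to a) ρ')
  extend-transports a ρ~ρ' zero    = refl
  extend-transports a ρ~ρ' (suc i) = ρ~ρ' i

  pair-transports : ∀ e e' → Transports (pair e e') (pair (to e) (to e'))
  pair-transports e e' zero    = refl
  pair-transports e e' (suc i) = refl

  ≼-invariant : ∀ {e e'} → e ≼ e' ⇔ to e ≼ to e'
  ≼-invariant {e} {e'} = mk⇔
    (subst₂ (λ c c' → c' ≤ c) (sym (countBot-π e)) (sym (countBot-π e')))
    (subst₂ (λ c c' → c' ≤ c) (countBot-π e) (countBot-π e'))

  ≡-invariant : ∀ {e e'} → e ≡ e' ⇔ to e ≡ to e'
  ≡-invariant = mk⇔ (cong to) (Injection.injective (↔⇒↣ π))

  invariant⇒transported : ∀ {k} {ρ ρ' : Fin k → PInst n} (A : PInst n → PInst n → Set) →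
                          Transports ρ ρ' → (∀ {e e'} → A e e' ⇔ A (to e) (to e')) →
                          ∀ x y → A (ρ x) (ρ y) ⇔ A (ρ' x) (ρ' y)
  invariant⇒transported {ρ = ρ} A ρ~ρ' A-invariant x y
    rewrite ρ~ρ' x | ρ~ρ' y = A-invariant {ρ x} {ρ y}

  Sat-invariant : ∀ {k} (T : DecisionTree n) (φ : Formula k) {ρ ρ'} →
                  Transports ρ ρ' → Sat T φ ρ ⇔ Sat T φ ρ'
  Sat-invariant T (prec x y) ρ~ρ' = invariant⇒transported _≼_ ρ~ρ' ≼-invariant x y
  Sat-invariant T (eq x y)   ρ~ρ' = invariant⇒transported _≡_ ρ~ρ' ≡-invariant x y
  Sat-invariant T (¬' φ)     ρ~ρ' = ¬-cong-⇔ (Sat-invariant T φ ρ~ρ')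
  Sat-invariant T (φ ∧' ψ)   ρ~ρ' = Sat-invariant T φ ρ~ρ' ×-⇔ Sat-invariant T ψ ρ~ρ'
  Sat-invariant T (φ ∨' ψ)   ρ~ρ' = Sat-invariant T φ ρ~ρ' ⊎-⇔ Sat-invariant T ψ ρ~ρ'
  Sat-invariant T (φ ⇒' ψ)   ρ~ρ' = →-cong-⇔ (Sat-invariant T φ ρ~ρ') (Sat-invariant T ψ ρ~ρ')
  Sat-invariant T (∃' φ)     ρ~ρ' = Σ-⇔ (↔⇒↠ π) (Sat-invariant T φ (extend-transports _ ρ~ρ'))
  Sat-invariant T (∀' φ)     ρ~ρ' = Π-⇔ π (Sat-invariant T φ (extend-transports _ ρ~ρ'))

complement : PVal → PVal
complement v0  = v1
complement v1  = v0
complement bot = bot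

complement-involutive : ∀ x → complement (complement x) ≡ x
complement-involutive v0  = refl
complement-involutive v1  = refl
complement-involutive bot = refl

flipIfSecondBot : PInst 2 → PInst 2
flipIfSecondBot (x ∷ bot ∷ []) = complement x ∷ bot ∷ []
flipIfSecondBot e              = e

flipIfSecondBot-involutive : ∀ e → flipIfSecondBot (flipIfSecondBot e) ≡ e
flipIfSecondBot-involutive (x ∷ bot ∷ []) = cong (_∷ bot ∷ []) (complement-involutive x)
flipIfSecondBot-involutive (x ∷ v0 ∷ [])  = refl
flipIfSecondBot-involutive (x ∷ v1 ∷ [])  = refl

flipIfSecondBot-↔ : PInst 2 ↔ PInst 2
flipIfSecondBot-↔ = mk↔ₛ′ flipIfSecondBot flipIfSecondBot
  flipIfSecondBot-involutive flipIfSecondBot-involutive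

countBot-flipIfSecondBot : ∀ e → countBot (flipIfSecondBot e) ≡ countBot e
countBot-flipIfSecondBot (v0  ∷ bot ∷ []) = refl
countBot-flipIfSecondBot (v1  ∷ bot ∷ []) = refl
countBot-flipIfSecondBot (bot ∷ bot ∷ []) = refl
countBot-flipIfSecondBot (x   ∷ v0  ∷ []) = refl
countBot-flipIfSecondBot (x   ∷ v1  ∷ []) = refl

subsumed-0⊥-00 : Subsumed (v0 ∷ bot ∷ []) (v0 ∷ v0 ∷ [])
subsumed-0⊥-00 zero       _    = refl
subsumed-0⊥-00 (suc zero) ⊥≢⊥ = ⊥-elim (⊥≢⊥ refl)

¬subsumed-1⊥-00 : ¬ Subsumed (v1 ∷ bot ∷ []) (v0 ∷ v0 ∷ [])
¬subsumed-1⊥-00 sub with () ← sub zero (λ ())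

lemma16 : ¬ Σ (Formula 2) (λ ψ →
            (n : ℕ) (T : DecisionTree n) (e e' : PInst n) →
              (Sat T ψ (pair e e') → Subsumed e e') × (Subsumed e e' → Sat T ψ (pair e e')))
lemma16 (ψ , defines) = ¬subsumed-1⊥-00 (proj₁ (defines 2 T e₃ e₂) ψ[e₃,e₂])
  where
  open BotCountPreserving flipIfSecondBot-↔ countBot-flipIfSecondBot

  T : DecisionTree 2
  T = leaf true , tt

  e₁ e₂ e₃ : PInst 2
  e₁ = v0 ∷ bot ∷ []
  e₂ = v0 ∷ v0 ∷ []
  e₃ = flipIfSecondBot e₁

  ψ[e₁,e₂] : Sat T ψ (pair e₁ e₂)
  ψ[e₁,e₂] = proj₂ (defines 2 T e₁ e₂) subsumed-0⊥-00

  ψ[e₃,e₂] : Sat T ψ (pair e₃ e₂)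
  ψ[e₃,e₂] = Equivalence.to (Sat-invariant T ψ (pair-transports e₁ e₂)) ψ[e₁,e₂]
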